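{- Let $\Delta$ be a bi-transitive bipartite digraph with edge set $E$, and let $v_1,v_2$ be distinct vertices of $\Delta$ of the same colour. If there exist (not necessarily distinct) vertices $u_1,u_2$ of $\Delta$ such that $v_1u_2\in E$, $v_2u_1\in E$, $u_2v_2\in E$ and $u_1v_1\in E$, then $v_1$ and $v_2$ are equivalent vertices of $\Delta$.
   Context: Digraphs have no loops or multiple edges; $uv$ is the edge with tail $u$ and head $v$; $N(u)$ and $N^-(u)$ are the out- and in-neighbourhoods of $u$. A bipartite digraph has its vertices partitioned into two colour classes with every edge joining different classes. It is bi-transitive if $u_1v_1,v_1u_2,u_2v_2\in E$ implies $u_1v_2\in E$. Two vertices $x,y$ are equivalent if $N(x)=N(y)$ and $N^-(x)=N^-(y)$. -}

module Defs where

open import Level using (Level; _⊔_; suc)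
open import Data.Bool using (Bool)
open import Data.Product using (_×_)
open import Relation.Binary.PropositionalEquality using (_≡_; _≢_)
open import Relation.Nullary using (¬_)
open import Function.Bundles using (_⇔_)

-- A digraph on vertex type V: an edge relation with no loops.
-- (No multiple edges is automatic: E is a relation.)
record Digraph (a ℓ : Level) : Set (suc (a ⊔ ℓ)) where
  field
    V     : Set a
    E     : V → V → Set ℓ        -- E u v : uv is an edge (tail u, head v)
    loopless : ∀ v → ¬ E v v

record BipartiteDigraph (a ℓ : Level) : Set (suc (a ⊔ ℓ)) where
  field
    digraph : Digraph a ℓ
  open Digraph digraph public
  field
    colour   : V → Bool
    proper   : ∀ {u v} → E u v → colour u ≢ colour v

module _ {a ℓ} (Δ : BipartiteDigraph a ℓ) where
  open BipartiteDigraph Δ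

  BiTransitive : Set (a ⊔ ℓ)
  BiTransitive = ∀ {u₁ v₁ u₂ v₂} → E u₁ v₁ → E v₁ u₂ → E u₂ v₂ → E u₁ v₂

  Equivalent : V → V → Set (a ⊔ ℓ)
  Equivalent x y = (∀ w → E x w ⇔ E y w) × (∀ w → E w x ⇔ E w y)

-- Bi-transitivity along a 2-path x → u → y transfers edges at y to x.
-- The hypothesis supplies such 2-paths from v₁ to v₂ and from v₂ to v₁, so the
-- neighbourhood inclusions hold in both directions.
module Submission where

open import Defs
open import Data.Product using (∃₂; _×_; _,_)
open import Relation.Binary.PropositionalEquality using (_≡_; _≢_)
open import Function.Bundles using (mk⇔)

module _ {a ℓ} (Δ : BipartiteDigraph a ℓ) (bt : BiTransitive Δ) where
  open BipartiteDigraph Δ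

  out-⊆-via-2-path : ∀ {x u y w} → E x u → E u y → E y w → E x w
  out-⊆-via-2-path xu uy yw = bt xu uy yw

  in-⊆-via-2-path : ∀ {x u y w} → E x u → E u y → E w x → E w y
  in-⊆-via-2-path xu uy wx = bt wx xu uy

  equivalent-if-2-paths-both-ways : ∀ {x y u₁ u₂} →
    E x u₂ → E u₂ y → E y u₁ → E u₁ x → Equivalent Δ x y
  equivalent-if-2-paths-both-ways xu₂ u₂y yu₁ u₁x =
    (λ w → mk⇔ (out-⊆-via-2-path yu₁ u₁x) (out-⊆-via-2-path xu₂ u₂y)) ,
    (λ w → mk⇔ (in-⊆-via-2-path xu₂ u₂y) (in-⊆-via-2-path yu₁ u₁x))

lemma2 : ∀ {a ℓ} (Δ : BipartiteDigraph a ℓ) → BiTransitive Δ →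
    ∀ (v₁ v₂ : BipartiteDigraph.V Δ) → v₁ ≢ v₂ →
    BipartiteDigraph.colour Δ v₁ ≡ BipartiteDigraph.colour Δ v₂ →
    (∃₂ λ u₁ u₂ → BipartiteDigraph.E Δ v₁ u₂ × BipartiteDigraph.E Δ v₂ u₁ ×
    BipartiteDigraph.E Δ u₂ v₂ × BipartiteDigraph.E Δ u₁ v₁) →
    Equivalent Δ v₁ v₂
lemma2 Δ bt _ _ _ _ (_ , _ , v₁u₂ , v₂u₁ , u₂v₂ , u₁v₁) =
  equivalent-if-2-paths-both-ways Δ bt v₁u₂ u₂v₂ v₂u₁ u₁v₁
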